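{- Let $\mathcal M=\langle W,R,\{\mathcal M_w\}_{w\in W}\rangle$ be a concrete mixed model, let $x,y$ be points of $\mathcal M$ and let $\varphi\in\mathsf{Form}_\Box$. Then: (1) if $x\leq y$, then $x\Vdash\Box\varphi$ if and only if $y\Vdash\Box\varphi$; (2) if $x\Vdash\varphi$ and $x\leq y$, then $y\Vdash\varphi$; (3) if $\vdash_{\mathsf{IPC}}\varphi$, then $x\Vdash\varphi$; (4) if $w\in W$ is such that $\mathcal M_w$ consists of the single world $\overline w$, then $\vdash_{\mathsf{CPC}}\varphi$ implies $\overline w\Vdash\varphi$.
   Context: The modal language $\mathsf{Form}_\Box$ is generated by $\top$, $\bot$, propositional variables $p\in\mathsf{Prop}$, and the constructors $(\varphi\wedge\psi)$, $(\varphi\vee\psi)$, $(\varphi\to\psi)$, $\Box\varphi$; $\neg\varphi$ abbreviates $\varphi\to\bot$. $\mathsf{IPC}$ (over the modal language) is the Hilbert system whose axioms are all instances, with $A,B,C$ arbitrary formulas of $\mathsf{Form}_\Box$, of the schemes $A\to(B\to A)$; $(A\to B)\to((A\to(B\to C))\to(A\to C))$; $A\to(A\vee B)$; $B\to(A\vee B)$; $(A\vee B)\to((A\to C)\to((B\to C)\to C))$; $A\to(B\to(A\wedge B))$; $(A\wedge B)\to A$; $(A\wedge B)\to B$; $\bot\to A$; its only rule is modus ponens (no necessitation). $\mathsf{CPC}$ is obtained by adding the scheme $\neg A\vee A$. An intuitionistic Kripke model is $\langle U,\leq,V\rangle$ with $U\neq\emptyset$, $\leq$ a partial order on $U$ and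 $V:U\to\mathcal P(\mathsf{Prop})$ monotone ($x\leq y\Rightarrow V(x)\subseteq V(y)$); it is rooted if it has a least element. A concrete mixed model is a triple $\langle W,R,\{\mathcal M_w\}_{w\in W}\rangle$ where $W$ is a nonempty set, $R\subseteq W\times W$, and each $\mathcal M_w=\langle W_w,\leq_w,V_w\rangle$ is a rooted intuitionistic Kripke model with root denoted $\overline w$, the domains $W_w$ being pairwise disjoint. The points of the model are the elements of $\bigcup_{w}W_w$; one writes $\leq$ for the union of the $\leq_w$ and $V$ for the union of the $V_w$; every point $x$ has a unique $w\in W$ with $\overline w\leq x$. Forcing at points: $x\Vdash p$ iff $p\in V(x)$; $x\nVdash\bot$ (and $x\Vdash\top$); $x\Vdash\varphi\wedge\psi$ iff both hold; $x\Vdash\varphi\vee\psi$ iff one holds; $x\Vdash\varphi\to\psi$ iff for all $y\geq x$, $y\Vdash\varphi$ implies $y\Vdash\psi$; $x\Vdash\Box\varphi$ iff for all $v\in W$ with $wRv$ we have $\overline v\Vdash\varphi$, where $w$ is the unique element of $W$ with $\overline w\leq x$. -}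

module Defs where

open import Level using (0ℓ)
open import Data.Product using (Σ; _×_; _,_)
open import Data.Sum using (_⊎_)
open import Data.Unit using (⊤)
open import Data.Empty using (⊥)
open import Relation.Binary.PropositionalEquality using (_≡_)
open import Relation.Binary.Structures using (IsPartialOrder)

data Form (Atom : Set) : Set where
  ⊤' ⊥' : Form Atom
  var  : Atom → Form Atom
  _∧'_ _∨'_ _⇒_ : Form Atom → Form Atom → Form Atom
  □_   : Form Atom → Form Atom

infixr 6 _∧'_
infixr 5 _∨'_
infixr 4 _⇒_

¬' : {Atom : Set} → Form Atom → Form Atom
¬' φ = φ ⇒ ⊥'

data IPC {Atom : Set} : Form Atom → Set where
  ax1 : ∀ A B → IPC (A ⇒ (B ⇒ A))
  ax2 : ∀ A B C → IPC ((A ⇒ B) ⇒ ((A ⇒ (B ⇒ C)) ⇒ (A ⇒ C)))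
  ax3 : ∀ A B → IPC (A ⇒ (A ∨' B))
  ax4 : ∀ A B → IPC (B ⇒ (A ∨' B))
  ax5 : ∀ A B C → IPC ((A ∨' B) ⇒ ((A ⇒ C) ⇒ ((B ⇒ C) ⇒ C)))
  ax6 : ∀ A B → IPC (A ⇒ (B ⇒ (A ∧' B)))
  ax7 : ∀ A B → IPC ((A ∧' B) ⇒ A)
  ax8 : ∀ A B → IPC ((A ∧' B) ⇒ B)
  ax9 : ∀ A → IPC (⊥' ⇒ A)
  mp  : ∀ {A B} → IPC (A ⇒ B) → IPC A → IPC B

data CPC {Atom : Set} : Form Atom → Set where
  ax1 : ∀ A B → CPC (A ⇒ (B ⇒ A))
  ax2 : ∀ A B C → CPC ((A ⇒ B) ⇒ ((A ⇒ (B ⇒ C)) ⇒ (A ⇒ C)))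
  ax3 : ∀ A B → CPC (A ⇒ (A ∨' B))
  ax4 : ∀ A B → CPC (B ⇒ (A ∨' B))
  ax5 : ∀ A B C → CPC ((A ∨' B) ⇒ ((A ⇒ C) ⇒ ((B ⇒ C) ⇒ C)))
  ax6 : ∀ A B → CPC (A ⇒ (B ⇒ (A ∧' B)))
  ax7 : ∀ A B → CPC ((A ∧' B) ⇒ A)
  ax8 : ∀ A B → CPC ((A ∧' B) ⇒ B)
  ax9 : ∀ A → CPC (⊥' ⇒ A)
  lem : ∀ A → CPC (¬' A ∨' A)
  mp  : ∀ {A B} → CPC (A ⇒ B) → CPC A → CPC B

record RootedKripke (Atom : Set) : Set₁ where
  field
    U     : Set
    _≤_   : U → U → Set
    isPO  : IsPartialOrder _≡_ _≤_
    V     : U → Atom → Set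
    mono  : ∀ {x y} → x ≤ y → ∀ p → V x p → V y p
    root  : U
    least : ∀ x → root ≤ x

-- Concrete mixed model. The domains are made pairwise disjoint by tagging:
-- the points are pairs (w , x) with x ∈ W_w.
record MixedModel (Atom : Set) : Set₁ where
  field
    W : Set
    R : W → W → Set
    M : W → RootedKripke Atom

  open RootedKripke

  Point : Set
  Point = Σ W (λ w → U (M w))

  rootPt : W → Point
  rootPt w = w , root (M w)

  data _≼_ : Point → Point → Set where
    within : ∀ {w x y} → _≤_ (M w) x y → (w , x) ≼ (w , y)

  -- forcing at points; the w with w̄ ≤ x is the tag of x
  _⊩_ : Point → Form Atom → Set
  (w , x) ⊩ ⊤' = ⊤
  (w , x) ⊩ ⊥' = ⊥
  (w , x) ⊩ var p = V (M w) x p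
  (w , x) ⊩ (φ ∧' ψ) = ((w , x) ⊩ φ) × ((w , x) ⊩ ψ)
  (w , x) ⊩ (φ ∨' ψ) = ((w , x) ⊩ φ) ⊎ ((w , x) ⊩ ψ)
  (w , x) ⊩ (φ ⇒ ψ) = ∀ y → _≤_ (M w) x y → (w , y) ⊩ φ → (w , y) ⊩ ψ
  (w , x) ⊩ (□ φ) = ∀ v → R w v → rootPt v ⊩ φ

{-# OPTIONS --safe #-}
module Submission where

open import Defs
open import Level using (0ℓ)
open import Function using (id)
open import Data.Product using (_×_; _,_; proj₁; proj₂)
open import Data.Sum using (inj₁; inj₂)
open import Data.Unit using (tt)
open import Relation.Nullary using (yes; no)
open import Relation.Binary.PropositionalEquality using (_≡_; subst; sym; trans)
open import Relation.Binary.Structures using (IsPartialOrder)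
open import Axiom.ExcludedMiddle using (ExcludedMiddle)

-- Forcing at a point (w , x) only ever looks at points above x inside the same
-- component M_w, except for □, which jumps to roots of other components and
-- does not depend on x at all. So each component behaves like an ordinary
-- intuitionistic Kripke model in which the □-formulas act as constant atoms,
-- and persistence and soundness are the usual arguments. In a one-point
-- component ¬A just says that A fails at that point, so ¬A ∨ A is forced by
-- excluded middle in the metatheory.

module Soundness {Atom : Set} (𝓜 : MixedModel Atom) where
  open MixedModel 𝓜

  module Component (w : W) where
    open RootedKripke (M w) using (U; _≤_; isPO; root)
    open IsPartialOrder isPO using () renaming (refl to ≤-refl; trans to ≤-trans)

    _⊩ʷ_ : U → Form Atom → Set
    x ⊩ʷ φ = (w , x) ⊩ φ

    Valid : Form Atom → Set
    Valid φ = ∀ x → x ⊩ʷ φ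

    ⊩-mono : ∀ φ {x y} → x ≤ y → x ⊩ʷ φ → y ⊩ʷ φ
    ⊩-mono ⊤'       _   _                 = tt
    ⊩-mono ⊥'       _   ()
    ⊩-mono (var p)  x≤y x⊩p               = RootedKripke.mono (M w) x≤y p x⊩p
    ⊩-mono (φ ∧' ψ) x≤y (x⊩φ , x⊩ψ)       = ⊩-mono φ x≤y x⊩φ , ⊩-mono ψ x≤y x⊩ψ
    ⊩-mono (φ ∨' ψ) x≤y (inj₁ x⊩φ)        = inj₁ (⊩-mono φ x≤y x⊩φ)
    ⊩-mono (φ ∨' ψ) x≤y (inj₂ x⊩ψ)        = inj₂ (⊩-mono ψ x≤y x⊩ψ)
    ⊩-mono (φ ⇒ ψ)  x≤y x⊩φ⇒ψ z y≤z       = x⊩φ⇒ψ z (≤-trans x≤y y≤z)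
    ⊩-mono (□ φ)    _   x⊩□φ              = x⊩□φ

    K-valid : ∀ A B → Valid (A ⇒ (B ⇒ A))
    K-valid A B x y _ y⊩A z y≤z _ = ⊩-mono A y≤z y⊩A

    S-valid : ∀ A B C → Valid ((A ⇒ B) ⇒ ((A ⇒ (B ⇒ C)) ⇒ (A ⇒ C)))
    S-valid A B C x y _ y⊩A⇒B z y≤z z⊩A⇒B⇒C u z≤u u⊩A =
      z⊩A⇒B⇒C u z≤u u⊩A u ≤-refl (y⊩A⇒B u (≤-trans y≤z z≤u) u⊩A)

    ∨-introˡ-valid : ∀ A B → Valid (A ⇒ (A ∨' B))
    ∨-introˡ-valid A B x y _ = inj₁

    ∨-introʳ-valid : ∀ A B → Valid (B ⇒ (A ∨' B))
    ∨-introʳ-valid A B x y _ = inj₂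

    ∨-elim-valid : ∀ A B C → Valid ((A ∨' B) ⇒ ((A ⇒ C) ⇒ ((B ⇒ C) ⇒ C)))
    ∨-elim-valid A B C x y _ (inj₁ y⊩A) z y≤z z⊩A⇒C u z≤u _ =
      z⊩A⇒C u z≤u (⊩-mono A (≤-trans y≤z z≤u) y⊩A)
    ∨-elim-valid A B C x y _ (inj₂ y⊩B) z y≤z _ u z≤u u⊩B⇒C =
      u⊩B⇒C u ≤-refl (⊩-mono B (≤-trans y≤z z≤u) y⊩B)

    ∧-intro-valid : ∀ A B → Valid (A ⇒ (B ⇒ (A ∧' B)))
    ∧-intro-valid A B x y _ y⊩A z y≤z z⊩B = ⊩-mono A y≤z y⊩A , z⊩B

    ∧-elimˡ-valid : ∀ A B → Valid ((A ∧' B) ⇒ A)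
    ∧-elimˡ-valid A B x y _ = proj₁

    ∧-elimʳ-valid : ∀ A B → Valid ((A ∧' B) ⇒ B)
    ∧-elimʳ-valid A B x y _ = proj₂

    ⊥-elim-valid : ∀ A → Valid (⊥' ⇒ A)
    ⊥-elim-valid A x y _ ()

    mp-valid : ∀ {A B} → Valid (A ⇒ B) → Valid A → Valid B
    mp-valid ⊩A⇒B ⊩A x = ⊩A⇒B x x ≤-refl (⊩A x)

    IPC-sound : ∀ {φ} → IPC φ → Valid φ
    IPC-sound (ax1 A B)   = K-valid A B
    IPC-sound (ax2 A B C) = S-valid A B C
    IPC-sound (ax3 A B)   = ∨-introˡ-valid A B
    IPC-sound (ax4 A B)   = ∨-introʳ-valid A B
    IPC-sound (ax5 A B C) = ∨-elim-valid A B C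
    IPC-sound (ax6 A B)   = ∧-intro-valid A B
    IPC-sound (ax7 A B)   = ∧-elimˡ-valid A B
    IPC-sound (ax8 A B)   = ∧-elimʳ-valid A B
    IPC-sound (ax9 A)     = ⊥-elim-valid A
    IPC-sound (mp {A} {B} d e) = mp-valid {A} {B} (IPC-sound d) (IPC-sound e)

    module Singleton (em : ExcludedMiddle 0ℓ) (single : ∀ y → y ≡ root) where

      LEM-valid : ∀ A → Valid (¬' A ∨' A)
      LEM-valid A x with em {x ⊩ʷ A}
      ... | yes x⊩A = inj₂ x⊩A
      ... | no  x⊮A = inj₁ λ y _ y⊩A →
        x⊮A (subst (_⊩ʷ A) (trans (single y) (sym (single x))) y⊩A)

      CPC-sound : ∀ {φ} → CPC φ → Valid φ
      CPC-sound (ax1 A B)   = K-valid A B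
      CPC-sound (ax2 A B C) = S-valid A B C
      CPC-sound (ax3 A B)   = ∨-introˡ-valid A B
      CPC-sound (ax4 A B)   = ∨-introʳ-valid A B
      CPC-sound (ax5 A B C) = ∨-elim-valid A B C
      CPC-sound (ax6 A B)   = ∧-intro-valid A B
      CPC-sound (ax7 A B)   = ∧-elimˡ-valid A B
      CPC-sound (ax8 A B)   = ∧-elimʳ-valid A B
      CPC-sound (ax9 A)     = ⊥-elim-valid A
      CPC-sound (lem A)     = LEM-valid A
      CPC-sound (mp {A} {B} d e) = mp-valid {A} {B} (CPC-sound d) (CPC-sound e)

lemma2p2p3 : {Atom : Set} (𝓜 : MixedModel Atom) →
    let open MixedModel 𝓜 in
    (∀ (x y : Point) (φ : Form Atom) → x ≼ y → ((x ⊩ (□ φ) → y ⊩ (□ φ)) × (y ⊩ (□ φ) → x ⊩ (□ φ))))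
    × (∀ (x y : Point) (φ : Form Atom) → x ⊩ φ → x ≼ y → y ⊩ φ)
    × (∀ (x : Point) (φ : Form Atom) → IPC φ → x ⊩ φ)
    × (ExcludedMiddle 0ℓ → ∀ (w : W) → (∀ (y : RootedKripke.U (M w)) → y ≡ RootedKripke.root (M w)) → ∀ (φ : Form Atom) → CPC φ → rootPt w ⊩ φ)
lemma2p2p3 𝓜 =
    (λ { x y φ (within _) → id , id })
  , (λ { x y φ x⊩φ (within {w} x≤y) → Component.⊩-mono w φ x≤y x⊩φ })
  , (λ { (w , x) φ ⊢φ → Component.IPC-sound w ⊢φ x })
  , (λ em w single φ ⊢φ → Component.Singleton.CPC-sound w em single ⊢φ (RootedKripke.root (M w)))
  where
    open MixedModel 𝓜
    open Soundness 𝓜
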